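{- Let $\ell\ge 1$ and let $a_1,\ldots,a_\ell$ be positive integers; set $a_0=0$ and $a_{\ell+1}=0$. For each $i=1,\ldots,\ell$ let $D_{\mu_i}\in\mathfrak{D}_{a_i}$. Then the poset $D_{\mu_1}\oplus D_{\mu_2}\oplus\cdots\oplus D_{\mu_\ell}$ is LE-cactus if and only if for every $i=1,2,\ldots,\ell$ the triple \[\Big(\sum_{r=0}^{i-1}a_r,\ a_i,\ \sum_{r=i+1}^{\ell+1}a_r\Big)\] is cactus-compatible.
   Context: Posets are finite. For a poset $X$ with $|X|=N$, a linear extension is a bijection $f:X\to\{1,\ldots,N\}$ with $f(a)<f(b)$ whenever $a<_X b$. For $1\le i\le N-1$ the Bender–Knuth involution $t_i$ acts on linear extensions of $X$ by swapping the labels $i$ and $i+1$ if $f^{ -1}(i)$ and $f^{ -1}(i+1)$ are incomparable in $X$, and leaving $f$ unchanged otherwise. Products of such maps denote composition, the rightmost factor acting first. Set $q_0=\mathrm{id}$ and $q_i=t_1(t_2t_1)(t_3t_2t_1)\cdots(t_it_{i-1}\cdots t_1)$ for $1\le i\le N-1$, and for $1\le j<k\le N$ set $q_{jk}=q_{k-1}q_{k-j}q_{k-1}$. A poset $X$ is LE-cactus if $(t_iq_{jk})^2$ acts as the identity on all linear extensions of $X$ for all integers $i,j,k$ with $1\le i$, $i+1<j<k\le |X|$. The ordinal sum $X\oplus Y$ has underlying set $X\sqcup Y$, keeps the orders of $X$ and $Y$, and puts every element of $X$ below every element of $Y$; the disjoint union $X+Y$ keeps the orders of $X$ and $Y$ with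 no relations between them. $C_m$ denotes the chain with $m$ elements. For a partition $\lambda=(\lambda_1,\ldots,\lambda_\ell)$ of $n$ with $\ell>1$, $D_\lambda=C_{\lambda_1}+\cdots+C_{\lambda_\ell}$. For $n>1$, $\mathfrak{D}_n$ is the set of posets $D_\lambda$ with $\lambda\vdash n$ having at least two parts (disjoint unions of at least two chains with $n$ elements total); $\mathfrak{D}_1=\{C_1\}$. A triple $(p,n,q)$ of integers ($p,q\ge0$, $n\ge1$) is cactus-compatible if: for all posets $P,Q$ with $|P|=p$, $|Q|=q$, every $D_\lambda\in\mathfrak{D}_n$, $R=P\oplus D_\lambda\oplus Q$, every linear extension $f$ of $R$, and all integers $1\le i$, $i+1<j<k\le p+n+q$, the linear extension $(t_iq_{jk})^2(f)$ agrees with $f$ on every element of $D_\lambda$. -}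

module Defs where

open import Data.Bool using (Bool; true; false; if_then_else_; _∧_; _∨_; not)
open import Data.Nat using (ℕ; zero; suc; _+_; _∸_; _≤_; _<_; _<ᵇ_; _≡ᵇ_)
open import Data.Fin using (Fin; zero; suc; toℕ; splitAt; raise; _↑ˡ_; _↑ʳ_)
import Data.Fin as Fin
open import Data.Sum using (_⊎_; inj₁; inj₂)
open import Data.Product using (_×_)
open import Data.Maybe using (Maybe; just; nothing)
import Data.Maybe as Maybe
open import Data.List using (List; []; _∷_; length)
open import Data.List.Relation.Unary.All using (All)
open import Data.List.Relation.Unary.Linked using (Linked)
open import Relation.Binary.PropositionalEquality using (_≡_)
open import Relation.Nullary.Decidable using (⌊_⌋)
open import Function using (_∘_; id)
open import Function.Definitions using (Bijective)

-- A poset with N elements is presented on the carrier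
-- Fin N by its strict order relation, given as a Bool-valued relation
-- (so comparability is decidable, as it is for any finite poset).

FRel : ℕ → Set
FRel n = Fin n → Fin n → Bool

IsPoset : ∀ {n} → FRel n → Set
IsPoset {n} R =
  ((x : Fin n) → R x x ≡ false) ×
  ((x y z : Fin n) → R x y ≡ true → R y z ≡ true → R x z ≡ true)

comparable : ∀ {n} → FRel n → Fin n → Fin n → Bool
comparable R a b = R a b ∨ R b a

private
  ordCase : ∀ {m n} → FRel m → FRel n → Fin m ⊎ Fin n → Fin m ⊎ Fin n → Bool
  ordCase P Q (inj₁ a) (inj₁ b) = P a b
  ordCase P Q (inj₂ a) (inj₂ b) = Q a b
  ordCase P Q (inj₁ a) (inj₂ b) = true
  ordCase P Q (inj₂ a) (inj₁ b) = false

  disjCase : ∀ {m n} → FRel m → FRel n → Fin m ⊎ Fin n → Fin m ⊎ Fin n → Bool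
  disjCase P Q (inj₁ a) (inj₁ b) = P a b
  disjCase P Q (inj₂ a) (inj₂ b) = Q a b
  disjCase P Q (inj₁ a) (inj₂ b) = false
  disjCase P Q (inj₂ a) (inj₁ b) = false

_⊕_ : ∀ {m n} → FRel m → FRel n → FRel (m + n)
_⊕_ {m} P Q x y = ordCase P Q (splitAt m x) (splitAt m y)

_⊞_ : ∀ {m n} → FRel m → FRel n → FRel (m + n)
_⊞_ {m} P Q x y = disjCase P Q (splitAt m x) (splitAt m y)

infixr 5 _⊕_ _⊞_

C : (m : ℕ) → FRel m
C m a b = toℕ a <ᵇ toℕ b

-- total of a list of parts (equal to the sum; the singleton case is
-- split off so that D (c ∷ []) is literally the chain C c)
total : List ℕ → ℕ
total [] = 0
total (c ∷ []) = c
total (c ∷ d ∷ cs) = c + total (d ∷ cs)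

IsPartition : List ℕ → Set
IsPartition lam = All (1 ≤_) lam × Linked (λ a b → b ≤ a) lam

D : (lam : List ℕ) → FRel (total lam)
D [] = λ ()
D (c ∷ []) = C c
D (c ∷ d ∷ cs) = C c ⊞ D (d ∷ cs)

-- the partition lam indexes an element D_lam of 𝔇_n
InFrakD : ℕ → List ℕ → Set
InFrakD n lam = IsPartition lam × total lam ≡ n ×
  ((n ≡ 1 × lam ≡ 1 ∷ []) ⊎ (1 < n × 2 ≤ length lam))

-- f : X → Fin N, the label of x being toℕ (f x) + 1 ∈ {1..N}
LinExt : ∀ {N} → FRel N → (Fin N → Fin N) → Set
LinExt {N} R f = Bijective _≡_ _≡_ f ×
  ((a b : Fin N) → R a b ≡ true → toℕ (f a) < toℕ (f b))

find : ∀ {n} → (Fin n → Bool) → Maybe (Fin n)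
find {zero} p = nothing
find {suc n} p = if p zero then just zero else Maybe.map suc (find (p ∘ suc))

Act : ℕ → Set
Act N = (Fin N → Fin N) → (Fin N → Fin N)

private
  swapAt : ∀ {N} → FRel N → (Fin N → Fin N) → Maybe (Fin N) → Maybe (Fin N) → Fin N → Fin N
  swapAt R f (just a) (just b) x =
    if comparable R a b then f x
    else (if ⌊ x Fin.≟ a ⌋ then f b else (if ⌊ x Fin.≟ b ⌋ then f a else f x))
  swapAt R f _ _ x = f x

-- t_i: swap the labels i and i+1 if f⁻¹(i), f⁻¹(i+1) are incomparable
t : ∀ {N} → FRel N → ℕ → Act N
t R i f = swapAt R f (find (λ a → suc (toℕ (f a)) ≡ᵇ i))
                     (find (λ b → suc (toℕ (f b)) ≡ᵇ suc i))

w : ∀ {N} → FRel N → ℕ → Act N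
w R zero = id
w R (suc i) = t R (suc i) ∘ w R i

-- q_0 = id,  q_i = t_1 (t_2 t_1) ⋯ (t_i ⋯ t_1) = q_{i-1} ∘ w_i
q : ∀ {N} → FRel N → ℕ → Act N
q R zero = id
q R (suc i) = q R i ∘ w R (suc i)

qjk : ∀ {N} → FRel N → ℕ → ℕ → Act N
qjk R j k = q R (k ∸ 1) ∘ q R (k ∸ j) ∘ q R (k ∸ 1)

cactusMap : ∀ {N} → FRel N → ℕ → ℕ → ℕ → Act N
cactusMap R i j k = (t R i ∘ qjk R j k) ∘ (t R i ∘ qjk R j k)

LECactus : ∀ {N} → FRel N → Set
LECactus {N} R = (i j k : ℕ) → 1 ≤ i → suc i < j → j < k → k ≤ N →
  (f : Fin N → Fin N) → LinExt R f →
  (x : Fin N) → cactusMap R i j k f x ≡ f x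

embMid : (p n q : ℕ) → Fin n → Fin (p + (n + q))
embMid p n q d = p ↑ʳ (d ↑ˡ q)

CactusCompatible : ℕ → ℕ → ℕ → Set
CactusCompatible p n q =
  (P : FRel p) → IsPoset P → (Q : FRel q) → IsPoset Q →
  (lam : List ℕ) → InFrakD n lam →
  (f : Fin (p + (total lam + q)) → Fin (p + (total lam + q))) →
  LinExt (P ⊕ D lam ⊕ Q) f →
  (i j k : ℕ) → 1 ≤ i → suc i < j → j < k → k ≤ p + (total lam + q) →
  (d : Fin (total lam)) →
  cactusMap (P ⊕ D lam ⊕ Q) i j k f (embMid p (total lam) q d)
    ≡ f (embMid p (total lam) q d)

bigTotal : List (List ℕ) → ℕ
bigTotal [] = 0
bigTotal (μ ∷ []) = total μ
bigTotal (μ ∷ ν ∷ μs) = total μ + bigTotal (ν ∷ μs)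

BigSum : (μs : List (List ℕ)) → FRel (bigTotal μs)
BigSum [] = λ ()
BigSum (μ ∷ []) = D μ
BigSum (μ ∷ ν ∷ μs) = D μ ⊕ BigSum (ν ∷ μs)

{-# OPTIONS --safe #-}
-- Consider a copy of D_λ (|λ| = n) in a poset with p elements below it, q above it and all other
-- elements comparable to it, like D_λ in P ⊕ D_λ ⊕ Q or D_{μ_i} in D_{μ_1} ⊕ ⋯ ⊕ D_{μ_ℓ}. In every
-- linear extension the copy carries exactly the labels p+1, …, p+n. A move t_c changes these
-- labels only when c and c+1 both lie in this window, and then it either exchanges them or leaves
-- them on two comparable elements, i.e. on one chain of D_λ. So, up to chains, a word in the t_c
-- permutes the labels of the copy by a permutation of the window that depends only on p, n and
-- the word. As labels increase along chains, the word fixes the labels of the copy in every linear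
-- extension when this permutation is trivial. Conversely, if it moves some label, composing with a
-- word that carries the two labels involved to the ends of the window shows, in the natural
-- labelling, that the first and the last element of D_λ lie on one chain, which fails as λ has at
-- least two parts. Both sides of the theorem therefore say that the permutation induced by
-- (t_i q_{jk})² is trivial on the window of each D_{μ_i}.
module Submission where

open import Defs
open import Data.Bool using (Bool; true; false; T; _∨_; if_then_else_)
import Data.Bool.Properties as Bool
open import Data.Empty using (⊥; ⊥-elim)
open import Data.Fin using (Fin; zero; suc; toℕ; fromℕ<; splitAt; cast; punchOut; _↑ˡ_; _↑ʳ_)
import Data.Fin.Properties as Fin
open import Data.List using (List; []; _∷_; _++_; length; map; take; drop; lookup)
open import Data.List.Membership.Propositional.Properties using (∈-lookup)
open import Data.List.Relation.Unary.All using (All; _∷_)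
import Data.List.Relation.Unary.All as All
open import Data.Maybe using (just; nothing)
open import Data.Nat using (ℕ; zero; suc; _+_; _∸_; _≤_; _<_; _≡ᵇ_; _<ᵇ_; _≟_; _≤?_; _<?_; z≤n; s≤s)
import Data.Nat.Properties as ℕ
open import Data.Nat.Induction using (<-rec)
open import Data.Nat.ListAction using (sum)
open import Data.Product using (∃; _×_; _,_; proj₁; proj₂)
open import Data.Sum using (_⊎_; inj₁; inj₂; [_,_]′)
open import Function using (_∘_; id; case_of_)
open import Function.Bundles using (Equivalence; _⇔_; mk⇔)
open import Function.Definitions using (Injective; Surjective; Bijective)
open import Relation.Binary using (tri<; tri≈; tri>)
open import Relation.Binary.PropositionalEquality
open import Relation.Nullary using (¬_; yes; no)
open import Relation.Nullary.Decidable using (⌊_⌋; _×-dec_)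

-- Bender–Knuth moves on labels

find-just : ∀ {n} (P : Fin n → Bool) {a} → find P ≡ just a → P a ≡ true
find-just {suc n} P eq with P zero in P0
find-just {suc n} P refl | true = P0
... | false with find (P ∘ suc) in found
find-just {suc n} P refl | false | just _ = find-just (P ∘ suc) found

find-nothing : ∀ {n} (P : Fin n → Bool) → find P ≡ nothing → ∀ a → P a ≡ false
find-nothing {suc n} P eq a with P zero in P0
... | false with find (P ∘ suc) in found
find-nothing {suc n} P eq zero    | false | nothing = P0
find-nothing {suc n} P eq (suc a) | false | nothing = find-nothing (P ∘ suc) found a

T⇒≡true : ∀ {b} → T b → b ≡ true
T⇒≡true = Equivalence.to Bool.T-≡

≡true⇒T : ∀ {b} → b ≡ true → T b
≡true⇒T = Equivalence.from Bool.T-≡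

swapAdj : ℕ → ℕ → ℕ
swapAdj c v with v ≟ c
... | yes _ = suc c
... | no _ with v ≟ suc c
...   | yes _ = c
...   | no _  = v

data SwapAdjView (c : ℕ) : ℕ → ℕ → Set where
  left  : SwapAdjView c c (suc c)
  right : SwapAdjView c (suc c) c
  other : ∀ {v} → v ≢ c → v ≢ suc c → SwapAdjView c v v

swapAdj-view : ∀ c v → SwapAdjView c v (swapAdj c v)
swapAdj-view c v with v ≟ c
... | yes refl = left
... | no v≢c with v ≟ suc c
...   | yes refl = right
...   | no v≢1+c = other v≢c v≢1+c

swapAdj-left : ∀ c → swapAdj c c ≡ suc c
swapAdj-left c with swapAdj c c | swapAdj-view c c
... | _ | left = refl
... | _ | other c≢c _ = ⊥-elim (c≢c refl)

swapAdj-right : ∀ c → swapAdj c (suc c) ≡ c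
swapAdj-right c with swapAdj c (suc c) | swapAdj-view c (suc c)
... | _ | right = refl
... | _ | other _ 1+c≢1+c = ⊥-elim (1+c≢1+c refl)

swapAdj-other : ∀ c {v} → v ≢ c → v ≢ suc c → swapAdj c v ≡ v
swapAdj-other c {v} v≢c v≢1+c with swapAdj c v | swapAdj-view c v
... | _ | left  = ⊥-elim (v≢c refl)
... | _ | right = ⊥-elim (v≢1+c refl)
... | _ | other _ _ = refl

swapAdj-involutive : ∀ c v → swapAdj c (swapAdj c v) ≡ v
swapAdj-involutive c v with swapAdj c v | swapAdj-view c v
... | _ | left  = swapAdj-right c
... | _ | right = swapAdj-left c
... | _ | other v≢c v≢1+c = swapAdj-other c v≢c v≢1+c

swapAdj-< : ∀ c {v N} → v < N → suc c < N → swapAdj c v < N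
swapAdj-< c {v} v<N 1+c<N with swapAdj c v | swapAdj-view c v
... | _ | left  = 1+c<N
... | _ | right = ℕ.<-trans (ℕ.n<1+n c) 1+c<N
... | _ | other _ _ = v<N

swapAdj-mono : ∀ c {u v} → u < v → ¬ (u ≡ c × v ≡ suc c) → swapAdj c u < swapAdj c v
swapAdj-mono c {u} {v} u<v notPair
  with swapAdj c u | swapAdj-view c u | swapAdj c v | swapAdj-view c v
... | _ | left  | _ | left  = ⊥-elim (ℕ.<-irrefl refl u<v)
... | _ | left  | _ | right = ⊥-elim (notPair (refl , refl))
... | _ | left  | _ | other _ v≢1+c = ℕ.≤∧≢⇒< u<v (v≢1+c ∘ sym)
... | _ | right | _ | left  = ⊥-elim (ℕ.<-asym u<v (ℕ.n<1+n c))
... | _ | right | _ | right = ⊥-elim (ℕ.<-irrefl refl u<v)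
... | _ | right | _ | other _ _ = ℕ.<-trans (ℕ.n<1+n c) u<v
... | _ | other _ _ | _ | left  = ℕ.<-trans u<v (ℕ.n<1+n c)
... | _ | other u≢c _ | _ | right = ℕ.≤∧≢⇒< (ℕ.≤-pred u<v) u≢c
... | _ | other _ _ | _ | other _ _ = u<v

t-zero : ∀ {N} (R : FRel N) h y → t R 0 h y ≡ h y
t-zero R h y with find (λ a → suc (toℕ (h a)) ≡ᵇ 0) in found
... | nothing = refl
... | just a with () ← find-just _ found

module _ {N : ℕ} (R : FRel N) (c : ℕ) (h : Fin N → Fin N) where
  private
    labelledC labelled1+C : Fin N → Bool
    labelledC   a = suc (toℕ (h a)) ≡ᵇ suc c
    labelled1+C b = suc (toℕ (h b)) ≡ᵇ suc (suc c)

  t-noFirst : find labelledC ≡ nothing → ∀ y → t R (suc c) h y ≡ h y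
  t-noFirst _ y with find labelledC
  t-noFirst refl y | nothing = refl

  t-noSecond : find labelled1+C ≡ nothing → ∀ y → t R (suc c) h y ≡ h y
  t-noSecond _ y with find labelledC | find labelled1+C
  t-noSecond refl y | nothing | nothing = refl
  t-noSecond refl y | just _  | nothing = refl

  t-comparable : ∀ {a b} → find labelledC ≡ just a → find labelled1+C ≡ just b →
                 comparable R a b ≡ true → ∀ y → t R (suc c) h y ≡ h y
  t-comparable _ _ ab y with find labelledC | find labelled1+C
  t-comparable refl refl ab y | just _ | just _ rewrite ab = refl

  t-incomparable : ∀ {a b} → find labelledC ≡ just a → find labelled1+C ≡ just b →
                   comparable R a b ≡ false → ∀ y →
                   t R (suc c) h y ≡ (if ⌊ y Fin.≟ a ⌋ then h b else (if ⌊ y Fin.≟ b ⌋ then h a else h y))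
  t-incomparable _ _ ab y with find labelledC | find labelled1+C
  t-incomparable refl refl ab y | just _ | just _ rewrite ab = refl

  label-found : ∀ {m a} → find (λ x → suc (toℕ (h x)) ≡ᵇ suc m) ≡ just a → toℕ (h a) ≡ m
  label-found {m} found = ℕ.≡ᵇ⇒≡ _ m (≡true⇒T (find-just _ found))

  label-notFound : ∀ {m} → find (λ x → suc (toℕ (h x)) ≡ᵇ suc m) ≡ nothing → ∀ a → toℕ (h a) ≢ m
  label-notFound {m} none a refl with () ← trans (sym (find-nothing _ none a)) (T⇒≡true (ℕ.≡⇒≡ᵇ m m refl))

label-injective : ∀ {N} {h : Fin N → Fin N} → Injective _≡_ _≡_ h →
                  ∀ {x y} → toℕ (h x) ≡ toℕ (h y) → x ≡ y
label-injective h-inj eq = h-inj (Fin.toℕ-injective eq)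

-- In the toℕ-convention of LinExt, t R (suc c) exchanges the labels c and suc c.
data BKMove {N} (R : FRel N) (c : ℕ) (h : Fin N → Fin N) : Set where
  blocked : (∀ y → t R (suc c) h y ≡ h y) →
            (∀ a b → toℕ (h a) ≡ c → toℕ (h b) ≡ suc c → comparable R a b ≡ true) →
            BKMove R c h
  swapped : ∀ a b → toℕ (h a) ≡ c → toℕ (h b) ≡ suc c → comparable R a b ≡ false →
            (∀ y → toℕ (t R (suc c) h y) ≡ swapAdj c (toℕ (h y))) →
            BKMove R c h

bkMove : ∀ {N} (R : FRel N) c h → Injective _≡_ _≡_ h → BKMove R c h
bkMove R c h h-inj
  with find (λ a → suc (toℕ (h a)) ≡ᵇ suc c) in foundA
     | find (λ b → suc (toℕ (h b)) ≡ᵇ suc (suc c)) in foundB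
... | nothing | _ = blocked (t-noFirst R c h foundA)
                            (λ a _ ha _ → ⊥-elim (label-notFound R c h foundA a ha))
... | just a | nothing = blocked (t-noSecond R c h foundB)
                                 (λ _ b _ hb → ⊥-elim (label-notFound R c h foundB b hb))
... | just a | just b with comparable R a b in ab
...   | true = blocked (t-comparable R c h foundA foundB ab) comparable-pair
  where
  comparable-pair : ∀ a′ b′ → toℕ (h a′) ≡ c → toℕ (h b′) ≡ suc c → comparable R a′ b′ ≡ true
  comparable-pair a′ b′ ha′ hb′
    rewrite label-injective h-inj (trans ha′ (sym (label-found R c h foundA)))
          | label-injective h-inj (trans hb′ (sym (label-found R c h foundB))) = ab
...   | false = swapped a b ha hb ab (λ y → trans (cong toℕ (t-incomparable R c h foundA foundB ab y)) (relabel y))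
  where
  ha : toℕ (h a) ≡ c
  ha = label-found R c h foundA
  hb : toℕ (h b) ≡ suc c
  hb = label-found R c h foundB
  relabel : ∀ y → toℕ (if ⌊ y Fin.≟ a ⌋ then h b else (if ⌊ y Fin.≟ b ⌋ then h a else h y))
                  ≡ swapAdj c (toℕ (h y))
  relabel y with y Fin.≟ a
  ... | yes refl = trans hb (sym (trans (cong (swapAdj c) ha) (swapAdj-left c)))
  ... | no y≢a with y Fin.≟ b
  ...   | yes refl = trans ha (sym (trans (cong (swapAdj c) hb) (swapAdj-right c)))
  ...   | no y≢b = sym (swapAdj-other c (λ hy≡c → y≢a (label-injective h-inj (trans hy≡c (sym ha))))
                                        (λ hy≡1+c → y≢b (label-injective h-inj (trans hy≡1+c (sym hb)))))

linExt-resp-≗ : ∀ {N} {R : FRel N} {g h : Fin N → Fin N} → (∀ y → g y ≡ h y) → LinExt R h → LinExt R g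
linExt-resp-≗ g≗h ((h-inj , h-surj) , h-mono) =
  ( (λ {x} {y} gx≡gy → h-inj (trans (sym (g≗h x)) (trans gx≡gy (g≗h y))))
  , (λ z → proj₁ (h-surj z) , λ {w} w≡x → trans (g≗h w) (proj₂ (h-surj z) w≡x)) )
  , λ a b r → subst₂ _<_ (sym (cong toℕ (g≗h a))) (sym (cong toℕ (g≗h b))) (h-mono a b r)

linExt-relabel : ∀ {N} {R : FRel N} {g h : Fin N → Fin N} (σ : ℕ → ℕ) →
  (∀ v → σ (σ v) ≡ v) → (∀ {v} → v < N → σ v < N) →
  (∀ y → toℕ (g y) ≡ σ (toℕ (h y))) → Bijective _≡_ _≡_ h →
  (∀ a b → R a b ≡ true → σ (toℕ (h a)) < σ (toℕ (h b))) → LinExt R g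
linExt-relabel {N} {g = g} {h} σ σσ σ< g≡σh (h-inj , h-surj) σh-mono =
  (g-inj , g-surj) , λ a b r → subst₂ _<_ (sym (g≡σh a)) (sym (g≡σh b)) (σh-mono a b r)
  where
  g-inj : Injective _≡_ _≡_ g
  g-inj {x} {y} gx≡gy = label-injective h-inj (begin
    toℕ (h x)          ≡⟨ σσ _ ⟨
    σ (σ (toℕ (h x)))  ≡⟨ cong σ (trans (sym (g≡σh x)) (trans (cong toℕ gx≡gy) (g≡σh y))) ⟩
    σ (σ (toℕ (h y)))  ≡⟨ σσ _ ⟩
    toℕ (h y)          ∎)
    where open ≡-Reasoning
  g-surj : Surjective _≡_ _≡_ g
  g-surj z = x , λ { refl → Fin.toℕ-injective (begin
    toℕ (g x)          ≡⟨ g≡σh x ⟩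
    σ (toℕ (h x))      ≡⟨ cong (σ ∘ toℕ) (proj₂ (h-surj target) refl) ⟩
    σ (toℕ target)     ≡⟨ cong σ (Fin.toℕ-fromℕ< _) ⟩
    σ (σ (toℕ z))      ≡⟨ σσ (toℕ z) ⟩
    toℕ z              ∎) }
    where
    open ≡-Reasoning
    target : Fin N
    target = fromℕ< (σ< (Fin.toℕ<n z))
    x : Fin N
    x = proj₁ (h-surj target)

t-linExt : ∀ {N} (R : FRel N) {h} → LinExt R h → ∀ i → LinExt R (t R i h)
t-linExt R h-ext zero = linExt-resp-≗ (t-zero R _) h-ext
t-linExt R {h} h-ext@((h-inj , _) , h-mono) (suc c) with bkMove R c h h-inj
... | blocked t≗h _ = linExt-resp-≗ t≗h h-ext
... | swapped a b ha hb ab t≡swap =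
  linExt-relabel (swapAdj c) (swapAdj-involutive c) (λ v<N → swapAdj-< c v<N (subst (_< _) hb (Fin.toℕ<n (h b))))
                 t≡swap (proj₁ h-ext) mono
  where
  mono : ∀ x y → R x y ≡ true → swapAdj c (toℕ (h x)) < swapAdj c (toℕ (h y))
  mono x y r = swapAdj-mono c (h-mono x y r) λ (hx , hy) →
    case trans (sym ab) (subst₂ (λ u v → comparable R u v ≡ true)
                           (label-injective h-inj (trans hx (sym ha)))
                           (label-injective h-inj (trans hy (sym hb)))
                           (cong (_∨ R y x) r)) of λ ()

applyWord : ∀ {N} → FRel N → List ℕ → Act N
applyWord R []       = id
applyWord R (i ∷ is) = t R i ∘ applyWord R is

wWord qWord : ℕ → List ℕ
wWord zero    = []
wWord (suc i) = suc i ∷ wWord i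
qWord zero    = []
qWord (suc i) = qWord i ++ wWord (suc i)

tqWord cactusWord : ℕ → ℕ → ℕ → List ℕ
tqWord i j k = i ∷ qWord (k ∸ 1) ++ qWord (k ∸ j) ++ qWord (k ∸ 1)
cactusWord i j k = tqWord i j k ++ tqWord i j k

module _ {N : ℕ} (R : FRel N) where

  applyWord-++ : ∀ u v f → applyWord R (u ++ v) f ≡ applyWord R u (applyWord R v f)
  applyWord-++ []      v f = refl
  applyWord-++ (i ∷ u) v f = cong (t R i) (applyWord-++ u v f)

  w-word : ∀ i f → w R i f ≡ applyWord R (wWord i) f
  w-word zero    f = refl
  w-word (suc i) f = cong (t R (suc i)) (w-word i f)

  q-word : ∀ i f → q R i f ≡ applyWord R (qWord i) f
  q-word zero    f = refl
  q-word (suc i) f = begin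
    q R i (w R (suc i) f)                              ≡⟨ q-word i _ ⟩
    applyWord R (qWord i) (w R (suc i) f)              ≡⟨ cong (applyWord R (qWord i)) (w-word (suc i) f) ⟩
    applyWord R (qWord i) (applyWord R (wWord (suc i)) f) ≡⟨ applyWord-++ (qWord i) (wWord (suc i)) f ⟨
    applyWord R (qWord (suc i)) f                      ∎
    where open ≡-Reasoning

  tq-word : ∀ i j k f → t R i (qjk R j k f) ≡ applyWord R (tqWord i j k) f
  tq-word i j k f = cong (t R i) (begin
    q R (k ∸ 1) (q R (k ∸ j) (q R (k ∸ 1) f))
      ≡⟨ cong (λ g → q R (k ∸ 1) (q R (k ∸ j) g)) (q-word (k ∸ 1) f) ⟩
    q R (k ∸ 1) (q R (k ∸ j) (applyWord R (qWord (k ∸ 1)) f))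
      ≡⟨ cong (q R (k ∸ 1)) (q-word (k ∸ j) _) ⟩
    q R (k ∸ 1) (applyWord R (qWord (k ∸ j)) (applyWord R (qWord (k ∸ 1)) f))
      ≡⟨ q-word (k ∸ 1) _ ⟩
    applyWord R (qWord (k ∸ 1)) (applyWord R (qWord (k ∸ j)) (applyWord R (qWord (k ∸ 1)) f))
      ≡⟨ cong (applyWord R (qWord (k ∸ 1))) (applyWord-++ (qWord (k ∸ j)) (qWord (k ∸ 1)) f) ⟨
    applyWord R (qWord (k ∸ 1)) (applyWord R (qWord (k ∸ j) ++ qWord (k ∸ 1)) f)
      ≡⟨ applyWord-++ (qWord (k ∸ 1)) _ f ⟨
    applyWord R (qWord (k ∸ 1) ++ qWord (k ∸ j) ++ qWord (k ∸ 1)) f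
      ∎)
    where open ≡-Reasoning

  cactusMap-word : ∀ i j k f → cactusMap R i j k f ≡ applyWord R (cactusWord i j k) f
  cactusMap-word i j k f = begin
    t R i (qjk R j k (t R i (qjk R j k f)))                   ≡⟨ cong (t R i ∘ qjk R j k) (tq-word i j k f) ⟩
    t R i (qjk R j k (applyWord R (tqWord i j k) f))          ≡⟨ tq-word i j k _ ⟩
    applyWord R (tqWord i j k) (applyWord R (tqWord i j k) f) ≡⟨ applyWord-++ (tqWord i j k) (tqWord i j k) f ⟨
    applyWord R (cactusWord i j k) f                          ∎
    where open ≡-Reasoning

  applyWord-linExt : ∀ u f → LinExt R f → LinExt R (applyWord R u f)
  applyWord-linExt []      f f-ext = f-ext
  applyWord-linExt (i ∷ u) f f-ext = t-linExt R (applyWord-linExt u f f-ext) i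

-- The permutation of a window of labels induced by a word

InBlock : ℕ → ℕ → ℕ → Set
InBlock p n v = p ≤ v × v < p + n

PairInBlock : ℕ → ℕ → ℕ → Set
PairInBlock p n c = p ≤ c × suc c < p + n

blockSwap : ℕ → ℕ → ℕ → ℕ → ℕ
blockSwap p n zero    v = v
blockSwap p n (suc c) v with (p ≤? c) ×-dec (suc c <? p + n)
... | yes _ = swapAdj c v
... | no _  = v

-- Tracks a label backwards through a word, keeping only the letters that act inside the window
-- [p, p+n): by origin-sameChain, before applyWord R u the label origin p n u v was carried by an
-- element on the chain of the block element that carries v afterwards.
origin : ℕ → ℕ → List ℕ → ℕ → ℕ
origin p n []       v = v
origin p n (i ∷ is) v = origin p n is (blockSwap p n i v)

blockSwap-inside : ∀ p n {c} v → PairInBlock p n c → blockSwap p n (suc c) v ≡ swapAdj c v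
blockSwap-inside p n {c} v inside with (p ≤? c) ×-dec (suc c <? p + n)
... | yes _ = refl
... | no outside = ⊥-elim (outside inside)

blockSwap-inBlock : ∀ p n i {v} → InBlock p n v → InBlock p n (blockSwap p n i v)
blockSwap-inBlock p n zero    v∈ = v∈
blockSwap-inBlock p n (suc c) {v} v∈ with (p ≤? c) ×-dec (suc c <? p + n)
... | no _ = v∈
... | yes (p≤c , 1+c<p+n) with swapAdj c v | swapAdj-view c v
...   | _ | left  = ℕ.m≤n⇒m≤1+n p≤c , 1+c<p+n
...   | _ | right = p≤c , ℕ.<-trans (ℕ.n<1+n c) 1+c<p+n
...   | _ | other _ _ = v∈

origin-++ : ∀ p n u u′ v → origin p n (u ++ u′) v ≡ origin p n u′ (origin p n u v)
origin-++ p n []      u′ v = refl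
origin-++ p n (i ∷ u) u′ v = origin-++ p n u u′ (blockSwap p n i v)

origin-inBlock : ∀ p n u {v} → InBlock p n v → InBlock p n (origin p n u v)
origin-inBlock p n []      v∈ = v∈
origin-inBlock p n (i ∷ u) v∈ = origin-inBlock p n u (blockSwap-inBlock p n i v∈)

blockSwap-offset : ∀ p n {a} v → suc a < n → blockSwap p n (suc (p + a)) v ≡ swapAdj (p + a) v
blockSwap-offset p n {a} v 1+a<n =
  blockSwap-inside p n v (ℕ.m≤m+n p a , subst (_< p + n) (ℕ.+-suc p a) (ℕ.+-monoʳ-< p 1+a<n))

swapAdj-offset-left : ∀ p a → swapAdj (p + a) (p + a) ≡ p + suc a
swapAdj-offset-left p a = trans (swapAdj-left (p + a)) (sym (ℕ.+-suc p a))

swapAdj-offset-right : ∀ p a → swapAdj (p + a) (p + suc a) ≡ p + a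
swapAdj-offset-right p a = trans (cong (swapAdj (p + a)) (ℕ.+-suc p a)) (swapAdj-right (p + a))

swapAdj-offset-other : ∀ p {a m} → m ≢ a → m ≢ suc a → swapAdj (p + a) (p + m) ≡ p + m
swapAdj-offset-other p {a} {m} m≢a m≢1+a =
  swapAdj-other (p + a) (m≢a ∘ ℕ.+-cancelˡ-≡ p _ _)
                        (m≢1+a ∘ ℕ.+-cancelˡ-≡ p _ _ ∘ (λ e → trans e (sym (ℕ.+-suc p a))))

sinkWord : ℕ → ℕ → List ℕ
sinkWord p zero    = []
sinkWord p (suc a) = suc (p + a) ∷ sinkWord p a

raiseWord : ℕ → ℕ → ℕ → List ℕ
raiseWord p k zero    = []
raiseWord p k (suc c) = suc (p + k) ∷ raiseWord p (suc k) c

module _ (p n : ℕ) where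

  origin-step : ∀ u {a} v {w} → suc a < n → swapAdj (p + a) v ≡ w →
                origin p n (suc (p + a) ∷ u) v ≡ origin p n u w
  origin-step u v 1+a<n swap≡w = cong (origin p n u) (trans (blockSwap-offset p n v 1+a<n) swap≡w)

  sink-above : ∀ {a m} → a < n → a < m → origin p n (sinkWord p a) (p + m) ≡ p + m
  sink-above {zero}  _ _ = refl
  sink-above {suc a} {m} 1+a<n 1+a<m =
    trans (origin-step (sinkWord p a) _ 1+a<n
                       (swapAdj-offset-other p (ℕ.<⇒≢ a<m ∘ sym) (ℕ.<⇒≢ 1+a<m ∘ sym)))
          (sink-above (ℕ.<-trans (ℕ.n<1+n a) 1+a<n) a<m)
    where
    a<m : a < m
    a<m = ℕ.<-trans (ℕ.n<1+n a) 1+a<m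

  sink-target : ∀ {a} → a < n → origin p n (sinkWord p a) (p + a) ≡ p
  sink-target {zero}  _ = ℕ.+-identityʳ p
  sink-target {suc a} 1+a<n =
    trans (origin-step (sinkWord p a) _ 1+a<n (swapAdj-offset-right p a))
          (sink-target (ℕ.<-trans (ℕ.n<1+n a) 1+a<n))

  sink-below : ∀ {a m} → a < n → m < a → origin p n (sinkWord p a) (p + m) ≡ p + suc m
  sink-below {suc a} {m} 1+a<n m<1+a with m ≟ a
  ... | yes refl = trans (origin-step (sinkWord p a) _ 1+a<n (swapAdj-offset-left p m))
                         (sink-above (ℕ.<-trans (ℕ.n<1+n a) 1+a<n) (ℕ.n<1+n a))
  ... | no m≢a = trans (origin-step (sinkWord p a) _ 1+a<n (swapAdj-offset-other p m≢a (ℕ.<⇒≢ m<1+a)))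
                       (sink-below (ℕ.<-trans (ℕ.n<1+n a) 1+a<n) (ℕ.≤∧≢⇒< (ℕ.≤-pred m<1+a) m≢a))

  raise-below : ∀ {k c m} → k + c < n → m < k → origin p n (raiseWord p k c) (p + m) ≡ p + m
  raise-below {k} {zero}  _ _ = refl
  raise-below {k} {suc c} {m} k+1+c<n m<k =
    trans (origin-step (raiseWord p (suc k) c) _ 1+k<n (swapAdj-offset-other p (ℕ.<⇒≢ m<k) (ℕ.<⇒≢ m<1+k)))
          (raise-below 1+k+c<n m<1+k)
    where
    1+k+c<n : suc k + c < n
    1+k+c<n = subst (_< n) (ℕ.+-suc k c) k+1+c<n
    1+k<n : suc k < n
    1+k<n = ℕ.≤-<-trans (ℕ.m≤m+n (suc k) c) 1+k+c<n
    m<1+k : m < suc k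
    m<1+k = ℕ.<-trans m<k (ℕ.n<1+n k)

  raise-target : ∀ k c → k + c < n → origin p n (raiseWord p k c) (p + k) ≡ p + (k + c)
  raise-target k zero    _ = cong (p +_) (sym (ℕ.+-identityʳ k))
  raise-target k (suc c) k+1+c<n =
    trans (origin-step (raiseWord p (suc k) c) _ 1+k<n (swapAdj-offset-left p k))
          (trans (raise-target (suc k) c 1+k+c<n) (cong (p +_) (sym (ℕ.+-suc k c))))
    where
    1+k+c<n : suc k + c < n
    1+k+c<n = subst (_< n) (ℕ.+-suc k c) k+1+c<n
    1+k<n : suc k < n
    1+k<n = ℕ.≤-<-trans (ℕ.m≤m+n (suc k) c) 1+k+c<n

  sink-other : ∀ {a s} → a < n → s < n → s ≢ a →
               ∃ λ s′ → origin p n (sinkWord p a) (p + s) ≡ p + s′ × 1 ≤ s′ × s′ < n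
  sink-other {a} {s} a<n s<n s≢a with ℕ.<-cmp s a
  ... | tri< s<a _ _ = suc s , sink-below a<n s<a , s≤s z≤n , ℕ.≤-<-trans s<a a<n
  ... | tri≈ _ s≡a _ = ⊥-elim (s≢a s≡a)
  ... | tri> _ _ a<s = s , sink-above a<n a<s , ℕ.≤-<-trans z≤n a<s , s<n

  origin-separates : ∀ {a s} → a < n → s < n → s ≢ a →
    ∃ λ u → origin p n u (p + a) ≡ p × origin p n u (p + s) ≡ p + (n ∸ 1)
  origin-separates {a} {s} a<n s<n s≢a with sink-other a<n s<n s≢a
  ... | s′ , sink-s , 1≤s′ , s′<n =
    sinkWord p a ++ raiseWord p s′ c , a-to-bottom , s-to-top
    where
    open ≡-Reasoning
    c : ℕ
    c = n ∸ 1 ∸ s′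
    1+[n∸1] : suc (n ∸ 1) ≡ n
    1+[n∸1] = ℕ.m+[n∸m]≡n {1} (ℕ.≤-<-trans z≤n s′<n)
    s′+c : s′ + c ≡ n ∸ 1
    s′+c = ℕ.m+[n∸m]≡n (ℕ.≤-pred (subst (suc s′ ≤_) (sym 1+[n∸1]) s′<n))
    s′+c<n : s′ + c < n
    s′+c<n = subst (_< n) (sym s′+c) (subst (n ∸ 1 <_) 1+[n∸1] (ℕ.n<1+n (n ∸ 1)))
    a-to-bottom : origin p n (sinkWord p a ++ raiseWord p s′ c) (p + a) ≡ p
    a-to-bottom = begin
      origin p n (sinkWord p a ++ raiseWord p s′ c) (p + a)      ≡⟨ origin-++ p n (sinkWord p a) _ _ ⟩
      origin p n (raiseWord p s′ c) (origin p n (sinkWord p a) (p + a))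
        ≡⟨ cong (origin p n (raiseWord p s′ c)) (trans (sink-target a<n) (sym (ℕ.+-identityʳ p))) ⟩
      origin p n (raiseWord p s′ c) (p + 0)                      ≡⟨ raise-below s′+c<n 1≤s′ ⟩
      p + 0                                                       ≡⟨ ℕ.+-identityʳ p ⟩
      p                                                           ∎
    s-to-top : origin p n (sinkWord p a ++ raiseWord p s′ c) (p + s) ≡ p + (n ∸ 1)
    s-to-top = begin
      origin p n (sinkWord p a ++ raiseWord p s′ c) (p + s)      ≡⟨ origin-++ p n (sinkWord p a) _ _ ⟩
      origin p n (raiseWord p s′ c) (origin p n (sinkWord p a) (p + s))
        ≡⟨ cong (origin p n (raiseWord p s′ c)) sink-s ⟩
      origin p n (raiseWord p s′ c) (p + s′)                     ≡⟨ raise-target s′ c s′+c<n ⟩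
      p + (s′ + c)                                                ≡⟨ cong (p +_) s′+c ⟩
      p + (n ∸ 1)                                                 ∎

inBlock-offset : ∀ {p n v} → InBlock p n v → ∃ λ a → a < n × p + a ≡ v
inBlock-offset {p} {n} {v} (p≤v , v<p+n) =
  v ∸ p , ℕ.+-cancelˡ-< p _ _ (subst (_< p + n) (sym p+[v∸p]) v<p+n) , p+[v∸p]
  where
  p+[v∸p] : p + (v ∸ p) ≡ v
  p+[v∸p] = ℕ.m+[n∸m]≡n p≤v

two-below : ∀ {n a s} → a < n → s < n → s ≢ a → 2 ≤ n
two-below {suc (suc _)} _         _         _   = s≤s (s≤s z≤n)
two-below {suc zero}    (s≤s z≤n) (s≤s z≤n) 0≢0 = ⊥-elim (0≢0 refl)

-- Chains of D_λ

chainOf : (lam : List ℕ) → Fin (total lam) → ℕ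
chainOf []           ()
chainOf (c ∷ [])     _ = 0
chainOf (c ∷ d ∷ cs) x = [ (λ _ → 0) , suc ∘ chainOf (d ∷ cs) ]′ (splitAt c x)

C-trichotomous : ∀ m {x y : Fin m} → x ≢ y → C m x y ≡ true ⊎ C m y x ≡ true
C-trichotomous m {x} {y} x≢y with ℕ.<-cmp (toℕ x) (toℕ y)
... | tri< x<y _ _ = inj₁ (T⇒≡true (ℕ.<⇒<ᵇ x<y))
... | tri≈ _ x≡y _ = ⊥-elim (x≢y (Fin.toℕ-injective x≡y))
... | tri> _ _ y<x = inj₂ (T⇒≡true (ℕ.<⇒<ᵇ y<x))

SameChainIfRelated : List ℕ → Set
SameChainIfRelated lam = ∀ {x y} → D lam x y ≡ true → chainOf lam x ≡ chainOf lam y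

related⇒sameChain-∷ : ∀ c d cs → SameChainIfRelated (d ∷ cs) → SameChainIfRelated (c ∷ d ∷ cs)
related⇒sameChain-∷ c d cs ih {x} {y} r with splitAt c x | splitAt c y
... | inj₁ _ | inj₁ _ = refl
... | inj₂ _ | inj₂ _ = cong suc (ih r)

related⇒sameChain : ∀ lam → SameChainIfRelated lam
related⇒sameChain (c ∷ [])     _ = refl
related⇒sameChain (c ∷ d ∷ cs)   = related⇒sameChain-∷ c d cs (related⇒sameChain (d ∷ cs))

ComparableIfSameChain : List ℕ → Set
ComparableIfSameChain lam = ∀ {x y} → chainOf lam x ≡ chainOf lam y → x ≢ y →
                            D lam x y ≡ true ⊎ D lam y x ≡ true

sameChain⇒comparable-∷ : ∀ c d cs → ComparableIfSameChain (d ∷ cs) → ComparableIfSameChain (c ∷ d ∷ cs)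
sameChain⇒comparable-∷ c d cs ih {x} {y} same x≢y with splitAt c x in ex | splitAt c y in ey
... | inj₁ a | inj₁ b = C-trichotomous c λ a≡b →
      x≢y (trans (sym (Fin.splitAt⁻¹-↑ˡ ex)) (trans (cong (_↑ˡ _) a≡b) (Fin.splitAt⁻¹-↑ˡ ey)))
... | inj₂ a | inj₂ b = ih (ℕ.suc-injective same) λ a≡b →
      x≢y (trans (sym (Fin.splitAt⁻¹-↑ʳ ex)) (trans (cong (c ↑ʳ_) a≡b) (Fin.splitAt⁻¹-↑ʳ ey)))

sameChain⇒comparable : ∀ lam → ComparableIfSameChain lam
sameChain⇒comparable (c ∷ [])     _ x≢y = C-trichotomous c x≢y
sameChain⇒comparable (c ∷ d ∷ cs)   = sameChain⇒comparable-∷ c d cs (sameChain⇒comparable (d ∷ cs))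

toℕ-splitAt-inj₁ : ∀ m {n} {x : Fin (m + n)} {a} → splitAt m x ≡ inj₁ a → toℕ x ≡ toℕ a
toℕ-splitAt-inj₁ m {n} {x} {a} eq = trans (cong toℕ (sym (Fin.splitAt⁻¹-↑ˡ eq))) (Fin.toℕ-↑ˡ a n)

toℕ-splitAt-inj₂ : ∀ m {n} {x : Fin (m + n)} {a} → splitAt m x ≡ inj₂ a → toℕ x ≡ m + toℕ a
toℕ-splitAt-inj₂ m {x = x} {a} eq = trans (cong toℕ (sym (Fin.splitAt⁻¹-↑ʳ eq))) (Fin.toℕ-↑ʳ m a)

total-positive : ∀ d cs → 1 ≤ d → 1 ≤ total (d ∷ cs)
total-positive d []      1≤d = 1≤d
total-positive d (_ ∷ _) 1≤d = ℕ.≤-trans 1≤d (ℕ.m≤m+n d _)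

first≢last-chain : ∀ c d cs → 1 ≤ c → 1 ≤ d → ∀ x y → toℕ x ≡ 0 → suc (toℕ y) ≡ total (c ∷ d ∷ cs) →
                   chainOf (c ∷ d ∷ cs) x ≢ chainOf (c ∷ d ∷ cs) y
first≢last-chain c d cs 1≤c 1≤d x y x≡0 1+y≡total with splitAt c x in ex | splitAt c y in ey
... | inj₂ a | _ = λ _ → ℕ.<⇒≢ (ℕ.≤-trans 1≤c (ℕ.m≤m+n c (toℕ a)))
                                (sym (trans (sym (toℕ-splitAt-inj₂ c ex)) x≡0))
... | inj₁ _ | inj₁ b = λ _ → ℕ.<-irrefl refl (ℕ.<-≤-trans (Fin.toℕ<n b) c≤y)
  where
  c≤y : c ≤ toℕ b
  c≤y = ℕ.+-cancelˡ-≤ 1 c (toℕ b) (begin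
    1 + c                  ≡⟨ ℕ.+-comm 1 c ⟩
    c + 1                  ≤⟨ ℕ.+-monoʳ-≤ c (total-positive d cs 1≤d) ⟩
    c + total (d ∷ cs)     ≡⟨ 1+y≡total ⟨
    suc (toℕ y)            ≡⟨ cong suc (toℕ-splitAt-inj₁ c ey) ⟩
    suc (toℕ b)            ∎)
    where open ℕ.≤-Reasoning
... | inj₁ _ | inj₂ _ = λ ()

frakD-first≢last-chain : ∀ {lam} → InFrakD (total lam) lam → 2 ≤ total lam →
  ∀ x y → toℕ x ≡ 0 → suc (toℕ y) ≡ total lam → chainOf lam x ≢ chainOf lam y
frakD-first≢last-chain (_ , _ , inj₁ (total≡1 , _)) 2≤total = ⊥-elim (ℕ.<-irrefl (sym total≡1) 2≤total)
frakD-first≢last-chain {c ∷ d ∷ cs} ((1≤c ∷ 1≤d ∷ _ , _) , _ , inj₂ _) _ = first≢last-chain c d cs 1≤c 1≤d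
frakD-first≢last-chain {c ∷ []} (_ , _ , inj₂ (_ , s≤s ())) _

module _ (lam : List ℕ) (g g′ : Fin (total lam) → ℕ) where

  -- Permuting labels within a chain would break monotonicity; induction on the label.
  labellings-agree :
    (∀ {x y} → g x ≡ g y → x ≡ y) →
    (∀ x y → D lam x y ≡ true → g x < g y) →
    (∀ x y → D lam x y ≡ true → g′ x < g′ y) →
    (∀ d → ∃ λ d″ → g d″ ≡ g′ d × chainOf lam d″ ≡ chainOf lam d) →
    (∀ d → ∃ λ d″ → g′ d″ ≡ g d) →
    ∀ d → g′ d ≡ g d
  labellings-agree g-inj g-mono g′-mono g′-in-chain g-in-g′ d = sym (<-rec P step (g′ d) d refl)
    where
    P : ℕ → Set
    P m = ∀ d → g′ d ≡ m → g d ≡ m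
    step : ∀ m → (∀ {k} → k < m → P k) → P m
    step m ih d g′d≡m with g′-in-chain d
    ... | d″ , gd″≡g′d , same with d Fin.≟ d″
    ...   | yes refl = trans gd″≡g′d g′d≡m
    ...   | no d≢d″ with sameChain⇒comparable lam (sym same) d≢d″
    ...     | inj₁ d<d″ = ⊥-elim (ℕ.<-irrefl (sym (trans (sym g′d≡m) g′d≡gd)) gd<m)
      where
      gd<m : g d < m
      gd<m = subst (g d <_) (trans gd″≡g′d g′d≡m) (g-mono d d″ d<d″)
      g′d≡gd : g′ d ≡ g d
      g′d≡gd with g-in-g′ d
      ... | d₁ , g′d₁≡gd with g-inj (ih gd<m d₁ g′d₁≡gd)
      ...   | refl = g′d₁≡gd
    ...     | inj₂ d″<d =
      ⊥-elim (ℕ.<-irrefl (trans (sym (ih g′d″<m d″ refl)) (trans gd″≡g′d g′d≡m)) g′d″<m)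
      where
      g′d″<m : g′ d″ < m
      g′d″<m = subst (g′ d″ <_) g′d≡m (g′-mono d″ d d″<d)

NaturallyLabelled : ∀ {N} → FRel N → Set
NaturallyLabelled {N} R = ∀ (x y : Fin N) → R x y ≡ true → toℕ x < toℕ y

naturallyLabelled⇒linExt-id : ∀ {N} {R : FRel N} → NaturallyLabelled R → LinExt R id
naturallyLabelled⇒linExt-id natural = ((λ eq → eq) , λ z → z , λ eq → eq) , natural

C-naturallyLabelled : ∀ m → NaturallyLabelled (C m)
C-naturallyLabelled m x y r = ℕ.<ᵇ⇒< (toℕ x) (toℕ y) (≡true⇒T r)

⊞-naturallyLabelled : ∀ {m n} {P : FRel m} {Q : FRel n} →
  NaturallyLabelled P → NaturallyLabelled Q → NaturallyLabelled (P ⊞ Q)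
⊞-naturallyLabelled {m} P-nat Q-nat x y r with splitAt m x in ex | splitAt m y in ey
... | inj₁ a | inj₁ b = subst₂ _<_ (sym (toℕ-splitAt-inj₁ m ex)) (sym (toℕ-splitAt-inj₁ m ey)) (P-nat a b r)
... | inj₂ a | inj₂ b = subst₂ _<_ (sym (toℕ-splitAt-inj₂ m ex)) (sym (toℕ-splitAt-inj₂ m ey))
                                  (ℕ.+-monoʳ-< m (Q-nat a b r))

⊕-naturallyLabelled : ∀ {m n} {P : FRel m} {Q : FRel n} →
  NaturallyLabelled P → NaturallyLabelled Q → NaturallyLabelled (P ⊕ Q)
⊕-naturallyLabelled {m} P-nat Q-nat x y r with splitAt m x in ex | splitAt m y in ey
... | inj₁ a | inj₁ b = subst₂ _<_ (sym (toℕ-splitAt-inj₁ m ex)) (sym (toℕ-splitAt-inj₁ m ey)) (P-nat a b r)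
... | inj₂ a | inj₂ b = subst₂ _<_ (sym (toℕ-splitAt-inj₂ m ex)) (sym (toℕ-splitAt-inj₂ m ey))
                                  (ℕ.+-monoʳ-< m (Q-nat a b r))
... | inj₁ a | inj₂ b = subst₂ _<_ (sym (toℕ-splitAt-inj₁ m ex)) (sym (toℕ-splitAt-inj₂ m ey))
                                  (ℕ.<-≤-trans (Fin.toℕ<n a) (ℕ.m≤m+n m (toℕ b)))

D-naturallyLabelled : ∀ lam → NaturallyLabelled (D lam)
D-naturallyLabelled (c ∷ [])     = C-naturallyLabelled c
D-naturallyLabelled (c ∷ d ∷ cs) = ⊞-naturallyLabelled (C-naturallyLabelled c) (D-naturallyLabelled (d ∷ cs))

BigSum-naturallyLabelled : ∀ μs → NaturallyLabelled (BigSum μs)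
BigSum-naturallyLabelled (μ ∷ [])     = D-naturallyLabelled μ
BigSum-naturallyLabelled (μ ∷ ν ∷ μs) =
  ⊕-naturallyLabelled (D-naturallyLabelled μ) (BigSum-naturallyLabelled (ν ∷ μs))

C-isPoset : ∀ m → IsPoset (C m)
C-isPoset m = (λ x → <ᵇ-irrefl (toℕ x)) , λ x y z r s →
  T⇒≡true (ℕ.<⇒<ᵇ (ℕ.<-trans (C-naturallyLabelled m x y r) (C-naturallyLabelled m y z s)))
  where
  <ᵇ-irrefl : ∀ k → (k <ᵇ k) ≡ false
  <ᵇ-irrefl zero    = refl
  <ᵇ-irrefl (suc k) = <ᵇ-irrefl k

module _ {N m} {R : FRel N} {f : Fin N → Fin N} (f-ext : LinExt R f)
         (g : Fin m → Fin N) (g-inj : Injective _≡_ _≡_ g) {x : Fin N} where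
  private
    f-inj : Injective _≡_ _≡_ f
    f-inj = proj₁ (proj₁ f-ext)
    f-mono : ∀ a b → R a b ≡ true → toℕ (f a) < toℕ (f b)
    f-mono = proj₂ f-ext

  below⇒label-≥ : (∀ j → R (g j) x ≡ true) → m ≤ toℕ (f x)
  below⇒label-≥ below = Fin.injective⇒≤ {f = φ} φ-inj
    where
    φ : Fin m → Fin (toℕ (f x))
    φ j = fromℕ< (f-mono (g j) x (below j))
    φ-inj : Injective _≡_ _≡_ φ
    φ-inj eq = g-inj (label-injective f-inj (Fin.fromℕ<-injective _ _ _ _ eq))

  above⇒label-< : (∀ j → R x (g j) ≡ true) → toℕ (f x) + m < N
  above⇒label-< above =
    subst (suc (toℕ (f x)) + m ≤_) (ℕ.m+[n∸m]≡n (Fin.toℕ<n (f x))) (ℕ.+-monoʳ-≤ (suc (toℕ (f x))) m≤)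
    where
    gap : ∀ j → toℕ (f (g j)) ∸ suc (toℕ (f x)) < N ∸ suc (toℕ (f x))
    gap j = ℕ.∸-monoˡ-< (Fin.toℕ<n (f (g j))) (f-mono x (g j) (above j))
    ψ : Fin m → Fin (N ∸ suc (toℕ (f x)))
    ψ j = fromℕ< (gap j)
    ψ-inj : Injective _≡_ _≡_ ψ
    ψ-inj {i} {j} eq = g-inj (label-injective f-inj
      (ℕ.∸-cancelʳ-≡ (f-mono x (g i) (above i)) (f-mono x (g j) (above j))
                     (Fin.fromℕ<-injective _ _ (gap i) (gap j) eq)))
    m≤ : m ≤ N ∸ suc (toℕ (f x))
    m≤ = Fin.injective⇒≤ {f = ψ} ψ-inj

injective⇒surjective : ∀ {n} (φ : Fin n → Fin n) → Injective _≡_ _≡_ φ → ∀ z → ∃ λ d → φ d ≡ z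
injective⇒surjective {suc n} φ φ-inj z with Fin.any? (λ d → φ d Fin.≟ z)
... | yes hit = hit
... | no miss = ⊥-elim (ℕ.<-irrefl refl (Fin.injective⇒≤ {f = ψ} ψ-inj))
  where
  ψ : Fin (suc n) → Fin n
  ψ d = punchOut {i = z} {j = φ d} (λ z≡φd → miss (d , sym z≡φd))
  ψ-inj : Injective _≡_ _≡_ ψ
  ψ-inj {x} {y} eq = φ-inj (Fin.punchOut-injective {i = z} _ _ eq)

-- The situation of D_λ in P ⊕ D_λ ⊕ Q with |P| = p and |Q| = q, occupying positions p, …, p+n−1.
record Block {N} (R : FRel N) (lam : List ℕ) (p q : ℕ) : Set where
  field
    embed           : Fin (total lam) → Fin N
    embed-rel       : ∀ x y → R (embed x) (embed y) ≡ D lam x y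
    embed-toℕ       : ∀ d → toℕ (embed d) ≡ p + toℕ d
    below           : Fin p → Fin N
    below-injective : Injective _≡_ _≡_ below
    below-rel       : ∀ j d → R (below j) (embed d) ≡ true
    above           : Fin q → Fin N
    above-injective : Injective _≡_ _≡_ above
    above-rel       : ∀ j d → R (embed d) (above j) ≡ true
    size            : p + (total lam + q) ≡ N
    outside         : ∀ x → (∃ λ d → x ≡ embed d) ⊎ (∀ d → comparable R x (embed d) ≡ true)

  embed-injective : Injective _≡_ _≡_ embed
  embed-injective {x} {y} eq = Fin.toℕ-injective (ℕ.+-cancelˡ-≡ p _ _
    (trans (sym (embed-toℕ x)) (trans (cong toℕ eq) (embed-toℕ y))))

OriginFixes : ℕ → ℕ → List ℕ → Set
OriginFixes p n u = ∀ v → InBlock p n v → origin p n u v ≡ v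

module BlockLabels {N} {R : FRel N} {lam : List ℕ} {p q : ℕ} (B : Block R lam p q) where
  open Block B

  n : ℕ
  n = total lam

  module _ {f : Fin N → Fin N} (f-ext : LinExt R f) where

    label-inBlock : ∀ d → InBlock p n (toℕ (f (embed d)))
    label-inBlock d = below⇒label-≥ f-ext below below-injective (λ j → below-rel j d)
                    , ℕ.+-cancelʳ-< q _ _ (subst (toℕ (f (embed d)) + q <_) (sym size′)
                        (above⇒label-< f-ext above above-injective (λ j → above-rel j d)))
      where
      size′ : (p + n) + q ≡ N
      size′ = trans (ℕ.+-assoc p n q) size

    private
      f-inj : Injective _≡_ _≡_ f
      f-inj = proj₁ (proj₁ f-ext)
      offset : Fin n → ℕ
      offset d = proj₁ (inBlock-offset (label-inBlock d))
      offset<n : ∀ d → offset d < n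
      offset<n d = proj₁ (proj₂ (inBlock-offset (label-inBlock d)))
      p+offset : ∀ d → p + offset d ≡ toℕ (f (embed d))
      p+offset d = proj₂ (proj₂ (inBlock-offset (label-inBlock d)))
      φ : Fin n → Fin n
      φ d = fromℕ< (offset<n d)
      φ-inj : Injective _≡_ _≡_ φ
      φ-inj {x} {y} eq = embed-injective (label-injective f-inj (begin
        toℕ (f (embed x))  ≡⟨ p+offset x ⟨
        p + offset x       ≡⟨ cong (p +_) (Fin.fromℕ<-injective _ _ (offset<n x) (offset<n y) eq) ⟩
        p + offset y       ≡⟨ p+offset y ⟩
        toℕ (f (embed y))  ∎))
        where open ≡-Reasoning

    label-onto : ∀ {u} → InBlock p n u → ∃ λ d → toℕ (f (embed d)) ≡ u
    label-onto {u} u∈ with inBlock-offset u∈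
    ... | a , a<n , p+a≡u with injective⇒surjective φ φ-inj (fromℕ< a<n)
    ...   | d , φd≡a = d , (begin
      toℕ (f (embed d))         ≡⟨ p+offset d ⟨
      p + offset d              ≡⟨ cong (p +_) (trans (sym (Fin.toℕ-fromℕ< (offset<n d))) (cong toℕ φd≡a)) ⟩
      p + toℕ (fromℕ< a<n)      ≡⟨ cong (p +_) (Fin.toℕ-fromℕ< a<n) ⟩
      p + a                     ≡⟨ p+a≡u ⟩
      u                         ∎)
      where open ≡-Reasoning

  comparable⇒sameChain : ∀ {a b} → comparable R (embed a) (embed b) ≡ true → chainOf lam a ≡ chainOf lam b
  comparable⇒sameChain {a} {b} ab with R (embed a) (embed b) in a<b | R (embed b) (embed a) in b<a
  ... | true | _    = related⇒sameChain lam (trans (sym (embed-rel a b)) a<b)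
  ... | false | true = sym (related⇒sameChain lam (trans (sym (embed-rel b a)) b<a))

  incomparable⇒inBlock : ∀ {x d} → comparable R x (embed d) ≡ false → ∃ λ d′ → x ≡ embed d′
  incomparable⇒inBlock {x} {d} x∥d with outside x
  ... | inj₁ inside = inside
  ... | inj₂ comparableToAll with () ← trans (sym x∥d) (comparableToAll d)

  module _ {h : Fin N → Fin N} (h-ext : LinExt R h) {c : ℕ} where
    private
      h-inj : Injective _≡_ _≡_ h
      h-inj = proj₁ (proj₁ h-ext)

    blocked-origin : (∀ a b → toℕ (h a) ≡ c → toℕ (h b) ≡ suc c → comparable R a b ≡ true) →
      ∀ d → ∃ λ d″ → toℕ (h (embed d″)) ≡ blockSwap p n (suc c) (toℕ (h (embed d)))
                   × chainOf lam d″ ≡ chainOf lam d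
    blocked-origin cmp d with (p ≤? c) ×-dec (suc c <? p + n)
    ... | no _ = d , refl , refl
    ... | yes (p≤c , 1+c<p+n) = inside (toℕ (h (embed d))) refl
      where
      inside : ∀ v → toℕ (h (embed d)) ≡ v →
               ∃ λ d″ → toℕ (h (embed d″)) ≡ swapAdj c v × chainOf lam d″ ≡ chainOf lam d
      inside v hd≡v with swapAdj c v | swapAdj-view c v
      ... | _ | left = case label-onto h-ext (ℕ.m≤n⇒m≤1+n p≤c , 1+c<p+n) of λ where
        (d″ , hd″≡1+c) → d″ , hd″≡1+c , sym (comparable⇒sameChain (cmp _ _ hd≡v hd″≡1+c))
      ... | _ | right = case label-onto h-ext (p≤c , ℕ.<-trans (ℕ.n<1+n c) 1+c<p+n) of λ where
        (d″ , hd″≡c) → d″ , hd″≡c , comparable⇒sameChain (cmp _ _ hd″≡c hd≡v)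
      ... | _ | other _ _ = d , hd≡v , refl

    module _ {a b : Fin N} (ha : toℕ (h a) ≡ c) (hb : toℕ (h b) ≡ suc c) (a∥b : comparable R a b ≡ false) where

      private
        pairInBlock : ∀ {da db} → a ≡ embed da → b ≡ embed db → PairInBlock p n c
        pairInBlock refl refl = subst (p ≤_) ha (proj₁ (label-inBlock h-ext _))
                              , subst (_< p + n) hb (proj₂ (label-inBlock h-ext _))

        b∥a : comparable R b a ≡ false
        b∥a = trans (Bool.∨-comm (R b a) (R a b)) a∥b

        labelled-c⇒pairInBlock : ∀ {d} → toℕ (h (embed d)) ≡ c → PairInBlock p n c
        labelled-c⇒pairInBlock hd≡c with label-injective h-inj (trans ha (sym hd≡c))
        ... | refl = pairInBlock refl (proj₂ (incomparable⇒inBlock b∥a))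

        labelled-1+c⇒pairInBlock : ∀ {d} → toℕ (h (embed d)) ≡ suc c → PairInBlock p n c
        labelled-1+c⇒pairInBlock hd≡1+c with label-injective h-inj (trans hb (sym hd≡1+c))
        ... | refl = pairInBlock (proj₂ (incomparable⇒inBlock a∥b)) refl

      swapped-origin : ∀ d → toℕ (h (embed d)) ≡ blockSwap p n (suc c) (swapAdj c (toℕ (h (embed d))))
      swapped-origin d with (p ≤? c) ×-dec (suc c <? p + n)
      ... | yes _ = sym (swapAdj-involutive c _)
      ... | no outside = sym (swapAdj-other c (outside ∘ labelled-c⇒pairInBlock)
                                             (outside ∘ labelled-1+c⇒pairInBlock))

  t-origin : ∀ {h} → LinExt R h → ∀ i d →
    ∃ λ d″ → toℕ (h (embed d″)) ≡ blockSwap p n i (toℕ (t R i h (embed d)))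
           × chainOf lam d″ ≡ chainOf lam d
  t-origin {h} h-ext zero d = d , cong toℕ (sym (t-zero R h (embed d))) , refl
  t-origin {h} h-ext (suc c) d with bkMove R c h (proj₁ (proj₁ h-ext))
  ... | blocked t≗h cmp with blocked-origin h-ext cmp d
  ...   | d″ , hd″≡ , same =
    d″ , trans hd″≡ (cong (blockSwap p n (suc c) ∘ toℕ) (sym (t≗h (embed d)))) , same
  t-origin {h} h-ext (suc c) d | swapped a b ha hb a∥b t≡swap =
    d , trans (swapped-origin h-ext ha hb a∥b d) (cong (blockSwap p n (suc c)) (sym (t≡swap (embed d)))) , refl

  origin-sameChain : ∀ u {f} → LinExt R f → ∀ d d′ →
    toℕ (f (embed d′)) ≡ origin p n u (toℕ (applyWord R u f (embed d))) → chainOf lam d ≡ chainOf lam d′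
  origin-sameChain [] f-ext d d′ eq =
    cong (chainOf lam) (embed-injective (label-injective (proj₁ (proj₁ f-ext)) (sym eq)))
  origin-sameChain (i ∷ u) {f} f-ext d d′ eq with t-origin (applyWord-linExt R u f f-ext) i d
  ... | d″ , hd″≡ , same =
    trans (sym same) (origin-sameChain u f-ext d″ d′ (trans eq (cong (origin p n u) (sym hd″≡))))

  WordFixes : List ℕ → Set
  WordFixes u = ∀ f → LinExt R f → ∀ d → applyWord R u f (embed d) ≡ f (embed d)

  originFixes⇒wordFixes : ∀ u → OriginFixes p n u → WordFixes u
  originFixes⇒wordFixes u fixes f f-ext d =
    Fin.toℕ-injective (labellings-agree lam g g′ g-inj (mono f-ext) (mono f′-ext) g′-in-chain g-in-g′ d)
    where
    f′ : Fin N → Fin N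
    f′ = applyWord R u f
    f′-ext : LinExt R f′
    f′-ext = applyWord-linExt R u f f-ext
    g g′ : Fin n → ℕ
    g  d = toℕ (f (embed d))
    g′ d = toℕ (f′ (embed d))
    g-inj : ∀ {x y} → g x ≡ g y → x ≡ y
    g-inj = embed-injective ∘ label-injective (proj₁ (proj₁ f-ext))
    mono : ∀ {k} → LinExt R k → ∀ x y → D lam x y ≡ true → toℕ (k (embed x)) < toℕ (k (embed y))
    mono k-ext x y r = proj₂ k-ext (embed x) (embed y) (trans (embed-rel x y) r)
    g′-in-chain : ∀ d → ∃ λ d″ → g d″ ≡ g′ d × chainOf lam d″ ≡ chainOf lam d
    g′-in-chain d = case label-onto f-ext (label-inBlock f′-ext d) of λ where
      (d″ , gd″≡g′d) → d″ , gd″≡g′d ,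
        sym (origin-sameChain u f-ext d d″ (trans gd″≡g′d (sym (fixes _ (label-inBlock f′-ext d)))))
    g-in-g′ : ∀ d → ∃ λ d″ → g′ d″ ≡ g d
    g-in-g′ d = label-onto f′-ext (label-inBlock f-ext d)

  fixed-labels-sameChain : ∀ u → WordFixes u → ∀ {f} → LinExt R f → ∀ d d′ →
    toℕ (f (embed d′)) ≡ origin p n u (toℕ (f (embed d))) → chainOf lam d ≡ chainOf lam d′
  fixed-labels-sameChain u fixes {f} f-ext d d′ eq =
    origin-sameChain u f-ext d d′ (trans eq (cong (origin p n u ∘ toℕ) (sym (fixes f f-ext d))))

  natural-labels-sameChain : LinExt R id → ∀ u {a} d z → toℕ (applyWord R u id (embed d)) ≡ p + a →
    origin p n u (p + a) ≡ p + toℕ z → chainOf lam d ≡ chainOf lam z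
  natural-labels-sameChain id-ext u d z d↦p+a p+a↦z =
    origin-sameChain u id-ext d z (trans (embed-toℕ z) (trans (sym p+a↦z) (cong (origin p n u) (sym d↦p+a))))

  -- The labels p+a and p+s of applyWord R V id lie on one chain since u fixes labels, and on the
  -- chains of the first and the last element of D_λ by the choice of V.
  moved-within-block⇒⊥ : ∀ u → LinExt R id → InFrakD n lam → WordFixes u →
    ∀ {a s} → a < n → s < n → s ≢ a → origin p n u (p + a) ≡ p + s → ⊥
  moved-within-block⇒⊥ u id-ext frakD fixes {a} {s} a<n s<n s≢a a↦s
    with origin-separates p n a<n s<n s≢a
  ... | V , a↦bottom , s↦top = frakD-first≢last-chain frakD 2≤n bottom top
          (Fin.toℕ-fromℕ< 0<n) (trans (cong suc (Fin.toℕ-fromℕ< n∸1<n)) 1+[n∸1])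
          (trans (sym da~bottom) (trans da~ds ds~top))
    where
    2≤n : 2 ≤ n
    2≤n = two-below a<n s<n s≢a
    0<n : 0 < n
    0<n = ℕ.<-trans (s≤s z≤n) 2≤n
    1+[n∸1] : suc (n ∸ 1) ≡ n
    1+[n∸1] = ℕ.m+[n∸m]≡n {1} 0<n
    n∸1<n : n ∸ 1 < n
    n∸1<n = subst (n ∸ 1 <_) 1+[n∸1] (ℕ.n<1+n (n ∸ 1))
    bottom top : Fin n
    bottom = fromℕ< 0<n
    top    = fromℕ< n∸1<n
    f-ext : LinExt R (applyWord R V id)
    f-ext = applyWord-linExt R V id id-ext
    inBlock : ∀ {b} → b < n → InBlock p n (p + b)
    inBlock b<n = ℕ.m≤m+n p _ , ℕ.+-monoʳ-< p b<n
    da ds : Fin n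
    da = proj₁ (label-onto f-ext (inBlock a<n))
    ds = proj₁ (label-onto f-ext (inBlock s<n))
    da↦p+a : toℕ (applyWord R V id (embed da)) ≡ p + a
    da↦p+a = proj₂ (label-onto f-ext (inBlock a<n))
    ds↦p+s : toℕ (applyWord R V id (embed ds)) ≡ p + s
    ds↦p+s = proj₂ (label-onto f-ext (inBlock s<n))
    da~ds : chainOf lam da ≡ chainOf lam ds
    da~ds = fixed-labels-sameChain u fixes f-ext da ds
      (trans ds↦p+s (trans (sym a↦s) (cong (origin p n u) (sym da↦p+a))))
    da~bottom : chainOf lam da ≡ chainOf lam bottom
    da~bottom = natural-labels-sameChain id-ext V da bottom da↦p+a
      (trans a↦bottom (sym (trans (cong (p +_) (Fin.toℕ-fromℕ< 0<n)) (ℕ.+-identityʳ p))))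
    ds~top : chainOf lam ds ≡ chainOf lam top
    ds~top = natural-labels-sameChain id-ext V ds top ds↦p+s
      (trans s↦top (cong (p +_) (sym (Fin.toℕ-fromℕ< n∸1<n))))

  wordFixes⇒originFixes : ∀ u → LinExt R id → InFrakD n lam → WordFixes u → OriginFixes p n u
  wordFixes⇒originFixes u id-ext frakD fixes v v∈ with origin p n u v ≟ v
  ... | yes fixed = fixed
  ... | no moved with inBlock-offset v∈ | inBlock-offset (origin-inBlock p n u v∈)
  ...   | a , a<n , refl | s , s<n , p+s≡w =
    ⊥-elim (moved-within-block⇒⊥ u id-ext frakD fixes a<n s<n (λ { refl → moved (sym p+s≡w) }) (sym p+s≡w))

data SplitView (m n : ℕ) : Fin (m + n) → Set where
  left  : ∀ i → SplitView m n (i ↑ˡ n)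
  right : ∀ j → SplitView m n (m ↑ʳ j)

splitView : ∀ m {n} (x : Fin (m + n)) → SplitView m n x
splitView m x with splitAt m x in eq
... | inj₁ i rewrite sym (Fin.splitAt⁻¹-↑ˡ eq) = left i
... | inj₂ j rewrite sym (Fin.splitAt⁻¹-↑ʳ eq) = right j

↑ˡ≢↑ʳ : ∀ {m n} (i : Fin m) (j : Fin n) → i ↑ˡ n ≢ m ↑ʳ j
↑ˡ≢↑ʳ {m} {n} i j eq = ℕ.<⇒≱ (Fin.toℕ<n i) (begin
  m                  ≤⟨ ℕ.m≤m+n m (toℕ j) ⟩
  m + toℕ j          ≡⟨ Fin.toℕ-↑ʳ m j ⟨
  toℕ (m ↑ʳ j)       ≡⟨ cong toℕ eq ⟨
  toℕ (i ↑ˡ n)       ≡⟨ Fin.toℕ-↑ˡ i n ⟩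
  toℕ i              ∎)
  where open ℕ.≤-Reasoning

module _ {a N} (A : FRel a) (R : FRel N) where

  ⊕-↑ˡ : ∀ x y → (A ⊕ R) (x ↑ˡ N) (y ↑ˡ N) ≡ A x y
  ⊕-↑ˡ x y rewrite Fin.splitAt-↑ˡ a x N | Fin.splitAt-↑ˡ a y N = refl

  ⊕-↑ʳ : ∀ x y → (A ⊕ R) (a ↑ʳ x) (a ↑ʳ y) ≡ R x y
  ⊕-↑ʳ x y rewrite Fin.splitAt-↑ʳ a N x | Fin.splitAt-↑ʳ a N y = refl

  ⊕-↑ˡ-↑ʳ : ∀ x y → (A ⊕ R) (x ↑ˡ N) (a ↑ʳ y) ≡ true
  ⊕-↑ˡ-↑ʳ x y rewrite Fin.splitAt-↑ˡ a x N | Fin.splitAt-↑ʳ a N y = refl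

  comparable-⊕-↑ˡ : ∀ x y → comparable (A ⊕ R) (x ↑ˡ N) (y ↑ˡ N) ≡ comparable A x y
  comparable-⊕-↑ˡ x y = cong₂ _∨_ (⊕-↑ˡ x y) (⊕-↑ˡ y x)

  comparable-⊕-↑ʳ : ∀ x y → comparable (A ⊕ R) (a ↑ʳ x) (a ↑ʳ y) ≡ comparable R x y
  comparable-⊕-↑ʳ x y = cong₂ _∨_ (⊕-↑ʳ x y) (⊕-↑ʳ y x)

  comparable-⊕-↑ˡ-↑ʳ : ∀ x y → comparable (A ⊕ R) (x ↑ˡ N) (a ↑ʳ y) ≡ true
  comparable-⊕-↑ˡ-↑ʳ x y = cong (_∨ (A ⊕ R) (a ↑ʳ y) (x ↑ˡ N)) (⊕-↑ˡ-↑ʳ x y)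

  comparable-⊕-↑ʳ-↑ˡ : ∀ x y → comparable (A ⊕ R) (a ↑ʳ y) (x ↑ˡ N) ≡ true
  comparable-⊕-↑ʳ-↑ˡ x y = trans (cong ((A ⊕ R) (a ↑ʳ y) (x ↑ˡ N) ∨_) (⊕-↑ˡ-↑ʳ x y)) (Bool.∨-zeroʳ _)

D-block : ∀ lam → Block (D lam) lam 0 0
D-block lam = record
  { embed = λ d → d ; embed-rel = λ _ _ → refl ; embed-toℕ = λ _ → refl
  ; below = λ () ; below-injective = λ { {()} } ; below-rel = λ ()
  ; above = λ () ; above-injective = λ { {()} } ; above-rel = λ ()
  ; size = ℕ.+-identityʳ (total lam)
  ; outside = λ x → inj₁ (x , refl)
  }

extendAbove : ∀ {N m} {R : FRel N} {lam p q} → Block R lam p q → (Z : FRel m) → Block (R ⊕ Z) lam p (q + m)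
extendAbove {N} {m} {R} {lam} {p} {q} B Z = record
  { embed = λ d → embed d ↑ˡ m
  ; embed-rel = λ x y → trans (⊕-↑ˡ R Z (embed x) (embed y)) (embed-rel x y)
  ; embed-toℕ = λ d → trans (Fin.toℕ-↑ˡ (embed d) m) (embed-toℕ d)
  ; below = λ j → below j ↑ˡ m
  ; below-injective = below-injective ∘ Fin.↑ˡ-injective m _ _
  ; below-rel = λ j d → trans (⊕-↑ˡ R Z (below j) (embed d)) (below-rel j d)
  ; above = above′
  ; above-injective = above′-injective
  ; above-rel = above′-rel
  ; size = size′
  ; outside = outside′
  }
  where
  open Block B
  above′ : Fin (q + m) → Fin (N + m)
  above′ j with splitView q j
  ... | left i  = above i ↑ˡ m
  ... | right k = N ↑ʳ k
  above′-injective : Injective _≡_ _≡_ above′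
  above′-injective {x} {y} eq with splitView q x | splitView q y
  ... | left i  | left j  = cong (_↑ˡ m) (above-injective (Fin.↑ˡ-injective m _ _ eq))
  ... | right k | right l = cong (q ↑ʳ_) (Fin.↑ʳ-injective N _ _ eq)
  ... | left i  | right l = ⊥-elim (↑ˡ≢↑ʳ _ _ eq)
  ... | right k | left j  = ⊥-elim (↑ˡ≢↑ʳ _ _ (sym eq))
  above′-rel : ∀ j d → (R ⊕ Z) (embed d ↑ˡ m) (above′ j) ≡ true
  above′-rel j d with splitView q j
  ... | left i  = trans (⊕-↑ˡ R Z (embed d) (above i)) (above-rel i d)
  ... | right k = ⊕-↑ˡ-↑ʳ R Z (embed d) k
  size′ : p + (total lam + (q + m)) ≡ N + m
  size′ = begin
    p + (total lam + (q + m))   ≡⟨ cong (p +_) (ℕ.+-assoc (total lam) q m) ⟨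
    p + (total lam + q + m)     ≡⟨ ℕ.+-assoc p (total lam + q) m ⟨
    p + (total lam + q) + m     ≡⟨ cong (_+ m) size ⟩
    N + m                       ∎
    where open ≡-Reasoning
  outside′ : ∀ x → (∃ λ d → x ≡ embed d ↑ˡ m) ⊎ (∀ d → comparable (R ⊕ Z) x (embed d ↑ˡ m) ≡ true)
  outside′ x with splitView N x
  ... | right k = inj₂ λ d → comparable-⊕-↑ʳ-↑ˡ R Z (embed d) k
  ... | left y with outside y
  ...   | inj₁ (d , refl) = inj₁ (d , refl)
  ...   | inj₂ comparableToAll = inj₂ λ d → trans (comparable-⊕-↑ˡ R Z y (embed d)) (comparableToAll d)

extendBelow : ∀ {a N} (A : FRel a) {R : FRel N} {lam p q} → Block R lam p q → Block (A ⊕ R) lam (a + p) q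
extendBelow {a} {N} A {R} {lam} {p} {q} B = record
  { embed = λ d → a ↑ʳ embed d
  ; embed-rel = λ x y → trans (⊕-↑ʳ A R (embed x) (embed y)) (embed-rel x y)
  ; embed-toℕ = λ d →
      trans (Fin.toℕ-↑ʳ a (embed d)) (trans (cong (a +_) (embed-toℕ d)) (sym (ℕ.+-assoc a p _)))
  ; below = below′
  ; below-injective = below′-injective
  ; below-rel = below′-rel
  ; above = λ j → a ↑ʳ above j
  ; above-injective = above-injective ∘ Fin.↑ʳ-injective a _ _
  ; above-rel = λ j d → trans (⊕-↑ʳ A R (embed d) (above j)) (above-rel j d)
  ; size = trans (ℕ.+-assoc a p _) (cong (a +_) size)
  ; outside = outside′
  }
  where
  open Block B
  below′ : Fin (a + p) → Fin (a + N)
  below′ j with splitView a j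
  ... | left i  = i ↑ˡ N
  ... | right k = a ↑ʳ below k
  below′-injective : Injective _≡_ _≡_ below′
  below′-injective {x} {y} eq with splitView a x | splitView a y
  ... | left i  | left j  = cong (_↑ˡ p) (Fin.↑ˡ-injective N _ _ eq)
  ... | right k | right l = cong (a ↑ʳ_) (below-injective (Fin.↑ʳ-injective a _ _ eq))
  ... | left i  | right l = ⊥-elim (↑ˡ≢↑ʳ _ _ eq)
  ... | right k | left j  = ⊥-elim (↑ˡ≢↑ʳ _ _ (sym eq))
  below′-rel : ∀ j d → (A ⊕ R) (below′ j) (a ↑ʳ embed d) ≡ true
  below′-rel j d with splitView a j
  ... | left i  = ⊕-↑ˡ-↑ʳ A R i (embed d)
  ... | right k = trans (⊕-↑ʳ A R (below k) (embed d)) (below-rel k d)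
  outside′ : ∀ x → (∃ λ d → x ≡ a ↑ʳ embed d) ⊎ (∀ d → comparable (A ⊕ R) x (a ↑ʳ embed d) ≡ true)
  outside′ x with splitView a x
  ... | left i = inj₂ λ d → comparable-⊕-↑ˡ-↑ʳ A R i (embed d)
  ... | right y with outside y
  ...   | inj₁ (d , refl) = inj₁ (d , refl)
  ...   | inj₂ comparableToAll = inj₂ λ d → trans (comparable-⊕-↑ʳ A R y (embed d)) (comparableToAll d)

cast-injective : ∀ {m n} .(eq : m ≡ n) → Injective _≡_ _≡_ (cast eq)
cast-injective eq {x} {y} cx≡cy =
  Fin.toℕ-injective (trans (sym (Fin.toℕ-cast eq x)) (trans (cong toℕ cx≡cy) (Fin.toℕ-cast eq y)))

-- By casts rather than transport, so that middleBlock embeds D_λ definitionally by embMid.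
reindex : ∀ {N} {R : FRel N} {lam p q p′ q′} → p ≡ p′ → q ≡ q′ → Block R lam p q → Block R lam p′ q′
reindex {lam = lam} p≡p′ q≡q′ B = record
  { embed = embed
  ; embed-rel = embed-rel
  ; embed-toℕ = λ d → trans (embed-toℕ d) (cong (_+ toℕ d) p≡p′)
  ; below = below ∘ cast (sym p≡p′)
  ; below-injective = cast-injective (sym p≡p′) ∘ below-injective
  ; below-rel = below-rel ∘ cast (sym p≡p′)
  ; above = above ∘ cast (sym q≡q′)
  ; above-injective = cast-injective (sym q≡q′) ∘ above-injective
  ; above-rel = above-rel ∘ cast (sym q≡q′)
  ; size = trans (cong₂ (λ p q → p + (total lam + q)) (sym p≡p′) (sym q≡q′)) size
  ; outside = outside
  }
  where open Block B

middleBlock : ∀ {p q} (P : FRel p) lam (Q : FRel q) → Block (P ⊕ D lam ⊕ Q) lam p q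
middleBlock {p} P lam Q = reindex (ℕ.+-identityʳ p) refl (extendBelow P (extendAbove (D-block lam) Q))

sum-bigTotal : ∀ μ μs → sum (map total (μ ∷ μs)) ≡ bigTotal (μ ∷ μs)
sum-bigTotal μ []       = ℕ.+-identityʳ (total μ)
sum-bigTotal μ (ν ∷ μs) = cong (total μ +_) (sum-bigTotal ν μs)

sizeBelow sizeAbove : (μs : List (List ℕ)) → Fin (length μs) → ℕ
sizeBelow μs b = sum (take (toℕ b) (map total μs))
sizeAbove μs b = sum (drop (suc (toℕ b)) (map total μs))

bigSumBlock : ∀ μs b → Block (BigSum μs) (lookup μs b) (sizeBelow μs b) (sizeAbove μs b)
bigSumBlock (μ ∷ [])     zero    = D-block μ
bigSumBlock (μ ∷ ν ∷ μs) zero    =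
  reindex refl (sym (sum-bigTotal ν μs)) (extendAbove (D-block μ) (BigSum (ν ∷ μs)))
bigSumBlock (μ ∷ ν ∷ μs) (suc b) = extendBelow (D μ) (bigSumBlock (ν ∷ μs) b)

InSomeBlock : (μs : List (List ℕ)) → Fin (bigTotal μs) → Set
InSomeBlock μs x = ∃ λ b → ∃ λ d → x ≡ Block.embed (bigSumBlock μs b) d

covered-∷ : ∀ μ ν μs → (∀ y → InSomeBlock (ν ∷ μs) y) → ∀ x → InSomeBlock (μ ∷ ν ∷ μs) x
covered-∷ μ ν μs covered x with splitView (total μ) x
... | left d  = zero , d , refl
... | right y with covered y
...   | b , d , refl = suc b , d , refl

bigSum-covered : ∀ μs x → InSomeBlock μs x
bigSum-covered (μ ∷ [])     x = zero , x , refl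
bigSum-covered (μ ∷ ν ∷ μs)   = covered-∷ μ ν μs (bigSum-covered (ν ∷ μs))

-- LE-cactus and cactus-compatibility as conditions on windows

CactusWordsFix : ℕ → ℕ → ℕ → Set
CactusWordsFix p n q = ∀ i j k → 1 ≤ i → suc i < j → j < k → k ≤ p + (n + q) →
                       OriginFixes p n (cactusWord i j k)

module _ {N} {R : FRel N} {lam p q} (B : Block R lam p q) where
  open Block B
  open BlockLabels B

  CactusFixes : Set
  CactusFixes = ∀ i j k → 1 ≤ i → suc i < j → j < k → k ≤ N →
                ∀ f → LinExt R f → ∀ d → cactusMap R i j k f (embed d) ≡ f (embed d)

  wordsFix⇒cactusFixes : CactusWordsFix p (total lam) q → CactusFixes
  wordsFix⇒cactusFixes fix i j k 1≤i 1+i<j j<k k≤N f f-ext d =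
    trans (cong-app (cactusMap-word R i j k f) (embed d))
          (originFixes⇒wordFixes (cactusWord i j k)
                                 (fix i j k 1≤i 1+i<j j<k (subst (k ≤_) (sym size) k≤N)) f f-ext d)

  cactusFixes⇒wordsFix : LinExt R id → InFrakD (total lam) lam → CactusFixes → CactusWordsFix p (total lam) q
  cactusFixes⇒wordsFix id-ext frakD fixes i j k 1≤i 1+i<j j<k k≤ =
    wordFixes⇒originFixes (cactusWord i j k) id-ext frakD λ f f-ext d →
      trans (sym (cong-app (cactusMap-word R i j k f) (embed d)))
            (fixes i j k 1≤i 1+i<j j<k (subst (k ≤_) size k≤) f f-ext d)

wordsFix⇒compatible : ∀ {p n q} → CactusWordsFix p n q → CactusCompatible p n q
wordsFix⇒compatible {p} {q = q} fix P _ Q _ lam (_ , total≡n , _) f f-ext i j k 1≤i 1+i<j j<k k≤ =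
  wordsFix⇒cactusFixes (middleBlock P lam Q) (subst (λ n → CactusWordsFix p n q) (sym total≡n) fix)
                       i j k 1≤i 1+i<j j<k k≤ f f-ext

compatible⇒wordsFix : ∀ {p q lam} → InFrakD (total lam) lam → CactusCompatible p (total lam) q →
                      CactusWordsFix p (total lam) q
compatible⇒wordsFix {p} {q} {lam} frakD compatible =
  cactusFixes⇒wordsFix (middleBlock (C p) lam (C q)) id-ext frakD
    λ i j k 1≤i 1+i<j j<k k≤ f f-ext →
      compatible (C p) (C-isPoset p) (C q) (C-isPoset q) lam frakD f f-ext i j k 1≤i 1+i<j j<k k≤
  where
  id-ext : LinExt (C p ⊕ D lam ⊕ C q) id
  id-ext = naturallyLabelled⇒linExt-id
    (⊕-naturallyLabelled (C-naturallyLabelled p)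
                         (⊕-naturallyLabelled (D-naturallyLabelled lam) (C-naturallyLabelled q)))

module _ (μs : List (List ℕ)) where

  LECactus⇒wordsFix : All (λ μ → InFrakD (total μ) μ) μs → LECactus (BigSum μs) →
    ∀ b → CactusWordsFix (sizeBelow μs b) (total (lookup μs b)) (sizeAbove μs b)
  LECactus⇒wordsFix frakDs cactus b =
    cactusFixes⇒wordsFix (bigSumBlock μs b) (naturallyLabelled⇒linExt-id (BigSum-naturallyLabelled μs))
      (All.lookup frakDs (∈-lookup b))
      λ i j k 1≤i 1+i<j j<k k≤N f f-ext d →
        cactus i j k 1≤i 1+i<j j<k k≤N f f-ext (Block.embed (bigSumBlock μs b) d)

  wordsFix⇒LECactus : (∀ b → CactusWordsFix (sizeBelow μs b) (total (lookup μs b)) (sizeAbove μs b)) →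
                      LECactus (BigSum μs)
  wordsFix⇒LECactus fix i j k 1≤i 1+i<j j<k k≤N f f-ext x with bigSum-covered μs x
  ... | b , d , refl = wordsFix⇒cactusFixes (bigSumBlock μs b) (fix b) i j k 1≤i 1+i<j j<k k≤N f f-ext d

theorem4p14 : (μs : List (List ℕ)) → 1 ≤ length μs →
    All (λ μ → InFrakD (total μ) μ) μs →
    LECactus (BigSum μs) ⇔
      ((i : Fin (length μs)) →
        CactusCompatible (sum (take (toℕ i) (map total μs)))
                         (total (lookup μs i))
                         (sum (drop (suc (toℕ i)) (map total μs))))
theorem4p14 μs _ frakDs = mk⇔
  (λ cactus b → wordsFix⇒compatible (LECactus⇒wordsFix μs frakDs cactus b))
  (λ compatible → wordsFix⇒LECactus μs λ b →
     compatible⇒wordsFix (All.lookup frakDs (∈-lookup b)) (compatible b))
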